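{- Let $I$ be a directed set and let $\langle T_i\ (i\in I);\ \Phi_i^j\ (i\le j)\rangle$ be a successful direct system of multi-embeddings, $T_i=\langle A_i,\mathcal F_i,D_i,G_i,\varphi_i\rangle$. Let $T^*=\langle A^*,\mathcal F^*,D^*,G^*,\varphi^*\rangle$ be its direct limit with canonical maps $\Phi_i:T_i\to T^*$. Then $\mathcal F^*$ (identified with a family of subsets of $A^*$) is homogeneous, $\varphi^*$ is defined on every demand in $D^*=D(A^*,\mathcal F^*)$ and $\varphi^*(d)\in G^*\subseteq\mathrm{Aut}(\mathcal F^*)$ satisfies $d$ for every $d\in D^*$ (so $\varphi^*$ testifies the homogeneity of $\mathcal F^*$), and each canonical map $\Phi_i:T_i\to T^*$ is a successful multi-embedding.
   Context: For $\mathcal F\subseteq\mathcal P(A)$: $\mathrm{Aut}(\mathcal F)$ is the group of permutations $\sigma$ of $A$ with $X\in\mathcal F\iff\sigma[X]\in\mathcal F$ for all $X\subseteq A$. A demand on $\mathcal F$ is a pair $d=(h^d,f^d)$, $h^d$ a finite injective partial function $A\to A$, $f^d$ a finite injective partial function $\mathcal F\to\mathcal F$, with $x\in X\iff h^d(x)\in f^d(X)$ for $x\in\mathrm{dom}\,h^d$, $X\in\mathrm{dom}\,f^d$; $D(A,\mathcal F)$ is the set of demands; $g\in\mathrm{Aut}(\mathcal F)$ satisfies $d$ if $g\supseteq h^d$ and $g[X]=f^d(X)$ for $X\in\mathrm{dom}\,f^d$. $\mathcal F$ is homogeneous if every demand is satisfied by some automorphism. A structure $T=\langle A,\mathcal F,D,G,\varphi\rangle$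 consists of a set $A$, $\mathcal F\subseteq\mathcal P(A)$, $D=D(A,\mathcal F)$, a subgroup $G\le\mathrm{Aut}(\mathcal F)$, and a partial satisfying homomorphism $\varphi$: a group homomorphism from the subgroup of the free group on $D$ generated by a subset $\mathrm{dom}\,\varphi\subseteq D$ into $G$ such that $\varphi(d)$ satisfies $d$ for all $d\in\mathrm{dom}\,\varphi$. Let $\bar T=A\cup\mathcal F\cup D\cup G$. A multi-embedding $\Phi:T_0\to T_1$ is a function on $\bar T_0$ such that $\Phi\restriction A_0$, $\Phi\restriction\mathcal F_0$, $\Phi\restriction D_0$ are injections into $A_1,\mathcal F_1,D_1$ respectively, $\Phi\restriction G_0$ is a group monomorphism into $G_1$, and for $x\in A_0,X\in\mathcal F_0,d\in D_0,g\in G_0$: (a) $x\in X\iff\Phi(x)\in\Phi(X)$; (b) $\Phi[\mathrm{dom}\,h^d]=\mathrm{dom}\,h^{\Phi(d)}$, $\Phi[\mathrm{dom}\,f^d]=\mathrm{dom}\,f^{\Phi(d)}$, $\Phi(h^d(x))=h^{\Phi(d)}(\Phi(x))$, $\Phi(f^d(X))=f^{\Phi(d)}(\Phi(X))$; (c) $\Phi(g(x))=\Phi(g)(\Phi(x))$ and $\Phi(g[X])=\Phi(g)[\Phi(X)]$; (d) if $d\in\mathrm{dom}\,\varphi_0$ then $\Phi(d)\in\mathrm{dom}\,\varphi_1$ and $\Phi(\varphi_0(d))=\varphi_1(\Phi(d))$. $\Phi$ is successful if moreover $\Phi(d)\in\mathrm{dom}\,\varphi_1$ for every $d\in D_0$.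 A direct system of multi-embeddings over a directed set $I$ consists of structures $T_i$ and multi-embeddings $\Phi_i^j:T_i\to T_j$ for $i\le j$ with $\Phi_i^i=\mathrm{id}$ and $\Phi_j^k\Phi_i^j=\Phi_i^k$ for $i\le j\le k$; it is successful if for every $i$ there is $j\ge i$ with $\Phi_i^j$ successful. Its direct limit $T^*$ is formed sortwise as the usual direct limit: $A^*=\bigsqcup_iA_i/\!\sim$ where $a\in A_i$, $b\in A_j$ are equivalent iff $\Phi_i^k(a)=\Phi_j^k(b)$ for some $k\ge i,j$, and similarly $\mathcal F^*,D^*,G^*$; $\Phi_i$ sends an element to its class; membership, the action of $G^*$, the components of demands, the group operation of $G^*$ and $\varphi^*$ are defined via representatives (e.g. $\Phi_i(x)\in\Phi_i(X)\iff x\in X$, $\varphi^*(\Phi_i(d))=\Phi_i(\varphi_i(d))$ for $d\in\mathrm{dom}\,\varphi_i$), each element of $\mathcal F^*$ being identified with its set of members in $A^*$. -}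

module Defs where

open import Level using (_⊔_)
open import Data.Product using (Σ; ∃; _×_; _,_)
open import Data.List using (List)
open import Data.List.Membership.Propositional using () renaming (_∈_ to _∈L_)
open import Data.Maybe using (Maybe; just; nothing)
open import Relation.Binary.PropositionalEquality using (_≡_)
open import Algebra.Structures using (IsGroup)

infix 3 _⟺_
_⟺_ : ∀ {a b} → Set a → Set b → Set (a ⊔ b)
P ⟺ Q = (P → Q) × (Q → P)

-- Finite partial functions, given by their (finite) graph as a list of
-- pairs; "h(x) = y" means (x , y) ∈ graph.

Dom : {X : Set} → List (X × X) → X → Set
Dom h x = ∃ λ y → (x , y) ∈L h

SameGraph : {X : Set} → List (X × X) → List (X × X) → Set
SameGraph h h' = ∀ p → (p ∈L h) ⟺ (p ∈L h')

IsFinPInj : {X : Set} → List (X × X) → Set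
IsFinPInj h =
  (∀ {x y y'} → (x , y) ∈L h → (x , y') ∈L h → y ≡ y') ×
  (∀ {x x' y} → (x , y) ∈L h → (x' , y) ∈L h → x ≡ x')

-- Families of subsets.  A family F ⊆ P(A) is given by an index type F
-- with a membership relation; extensionality (required in IsStructure)
-- makes it a genuine family of subsets.

module _ {A F : Set} (mem : A → F → Set) where

  InFam : (A → Set) → Set
  InFam P = Σ F λ X → ∀ a → mem a X ⟺ P a

  Image : (A → A) → (A → Set) → (A → Set)
  Image σ P b = ∃ λ a → P a × σ a ≡ b

  IsPerm : (A → A) → Set
  IsPerm σ = (∀ {a a'} → σ a ≡ σ a' → a ≡ a') × (∀ b → ∃ λ a → σ a ≡ b)

  IsAut : (A → A) → Set₁
  IsAut σ = IsPerm σ × (∀ (P : A → Set) → InFam P ⟺ InFam (Image σ P))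

  IsDemand : List (A × A) → List (F × F) → Set
  IsDemand h f = IsFinPInj h × IsFinPInj f ×
    (∀ {x y X Y} → (x , y) ∈L h → (X , Y) ∈L f → mem x X ⟺ mem y Y)

  Satisfies : (A → A) → List (A × A) → List (F × F) → Set
  Satisfies σ h f =
    (∀ {x y} → (x , y) ∈L h → σ x ≡ y) ×
    (∀ {X Y} → (X , Y) ∈L f → ∀ b → mem b Y ⟺ Image σ (λ a → mem a X) b)

  Homogeneous : Set₁
  Homogeneous = ∀ h f → IsDemand h f →
    Σ (A → A) λ σ → IsAut σ × Satisfies σ h f

-- Raw structures ⟨A, F, D, G, φ⟩ (data only).
-- φ is the partial satisfying homomorphism, given by its values on the
-- generators dom φ ⊆ D (a homomorphism from the free group on dom φ is
-- the same as a map dom φ → G).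

record RawStr : Set₁ where
  field
    A F D G : Set
    mem  : A → F → Set
    hd   : D → List (A × A)
    fd   : D → List (F × F)
    _·_  : G → G → G
    e    : G
    inv  : G → G
    act  : G → A → A
    actF : G → F → F
    φ    : D → Maybe G           -- d ∈ dom φ  iff  φ d ≡ just _

record IsStructure (T : RawStr) : Set₁ where
  open RawStr T
  field
    -- F ⊆ P(A)
    ext : ∀ X Y → (∀ a → mem a X ⟺ mem a Y) → X ≡ Y
    -- D = D(A, F)
    demand     : ∀ d → IsDemand mem (hd d) (fd d)
    demandInj  : ∀ d d' → SameGraph (hd d) (hd d') → SameGraph (fd d) (fd d') → d ≡ d'
    demandSurj : ∀ h f → IsDemand mem h f →
                   ∃ λ d → SameGraph (hd d) h × SameGraph (fd d) f
    -- G ≤ Aut(F)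
    group    : IsGroup _≡_ _·_ e inv
    actAut   : ∀ g → IsAut mem (act g)
    actHom   : ∀ g g' x → act (g · g') x ≡ act g (act g' x)
    faithful : ∀ g g' → (∀ x → act g x ≡ act g' x) → g ≡ g'
    actFSet  : ∀ g X b → mem b (actF g X) ⟺ Image mem (act g) (λ a → mem a X) b
    φSat : ∀ d g → φ d ≡ just g → Satisfies mem (act g) (hd d) (fd d)

record SortMaps (T₀ T₁ : RawStr) : Set where
  private
    module T₀ = RawStr T₀
    module T₁ = RawStr T₁
  field
    mA : T₀.A → T₁.A
    mF : T₀.F → T₁.F
    mD : T₀.D → T₁.D
    mG : T₀.G → T₁.G

module _ {T₀ T₁ : RawStr} (m : SortMaps T₀ T₁) where
  private
    module T₀ = RawStr T₀
    module T₁ = RawStr T₁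
  open SortMaps m

  record IsMultiEmb : Set where
    field
      injA : ∀ {x y} → mA x ≡ mA y → x ≡ y
      injF : ∀ {x y} → mF x ≡ mF y → x ≡ y
      injD : ∀ {x y} → mD x ≡ mD y → x ≡ y
      injG : ∀ {x y} → mG x ≡ mG y → x ≡ y
      homG : ∀ g g' → mG (g T₀.· g') ≡ mG g T₁.· mG g'
      memPres : ∀ x X → T₀.mem x X ⟺ T₁.mem (mA x) (mF X)
      hDom : ∀ d a → Dom (T₁.hd (mD d)) a ⟺ ∃ λ x → Dom (T₀.hd d) x × mA x ≡ a
      fDom : ∀ d Y → Dom (T₁.fd (mD d)) Y ⟺ ∃ λ X → Dom (T₀.fd d) X × mF X ≡ Y
      hVal : ∀ d {x y} → (x , y) ∈L T₀.hd d → (mA x , mA y) ∈L T₁.hd (mD d)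
      fVal : ∀ d {X Y} → (X , Y) ∈L T₀.fd d → (mF X , mF Y) ∈L T₁.fd (mD d)
      actPres  : ∀ g x → mA (T₀.act g x) ≡ T₁.act (mG g) (mA x)
      actFPres : ∀ g X → mF (T₀.actF g X) ≡ T₁.actF (mG g) (mF X)
      φPres : ∀ d g → T₀.φ d ≡ just g → T₁.φ (mD d) ≡ just (mG g)

  Successful : Set
  Successful = ∀ d → ∃ λ g → T₁.φ (mD d) ≡ just g

record Directed (I : Set) : Set₁ where
  field
    _≤_   : I → I → Set
    refl≤ : ∀ i → i ≤ i
    trans≤ : ∀ {i j k} → i ≤ j → j ≤ k → i ≤ k
    bound : ∀ i j → Σ I λ k → i ≤ k × j ≤ k
    inhabited : I

record DirSys {I : Set} (dir : Directed I) : Set₁ where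
  open Directed dir
  field
    T     : I → RawStr
    isStr : ∀ i → IsStructure (T i)
    Φ     : ∀ {i j} → i ≤ j → SortMaps (T i) (T j)
    isME  : ∀ {i j} (p : i ≤ j) → IsMultiEmb (Φ p)
    idA : ∀ {i} (p : i ≤ i) x → SortMaps.mA (Φ p) x ≡ x
    idF : ∀ {i} (p : i ≤ i) x → SortMaps.mF (Φ p) x ≡ x
    idD : ∀ {i} (p : i ≤ i) x → SortMaps.mD (Φ p) x ≡ x
    idG : ∀ {i} (p : i ≤ i) x → SortMaps.mG (Φ p) x ≡ x
    compA : ∀ {i j k} (p : i ≤ j) (q : j ≤ k) (r : i ≤ k) x →
              SortMaps.mA (Φ q) (SortMaps.mA (Φ p) x) ≡ SortMaps.mA (Φ r) x
    compF : ∀ {i j k} (p : i ≤ j) (q : j ≤ k) (r : i ≤ k) x →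
              SortMaps.mF (Φ q) (SortMaps.mF (Φ p) x) ≡ SortMaps.mF (Φ r) x
    compD : ∀ {i j k} (p : i ≤ j) (q : j ≤ k) (r : i ≤ k) x →
              SortMaps.mD (Φ q) (SortMaps.mD (Φ p) x) ≡ SortMaps.mD (Φ r) x
    compG : ∀ {i j k} (p : i ≤ j) (q : j ≤ k) (r : i ≤ k) x →
              SortMaps.mG (Φ q) (SortMaps.mG (Φ p) x) ≡ SortMaps.mG (Φ r) x

  SuccessfulSys : Set
  SuccessfulSys = ∀ i → Σ I λ j → Σ (i ≤ j) λ p → Successful (Φ p)

-- Since Agda has no quotient types, the sortwise direct
-- limit X* = ⊔ X_i / ∼ is characterised by its defining properties:
-- every element is the class Φ_i(x) of some representative, and
-- Φ_i(x) = Φ_j(y) iff Φ_i^k(x) = Φ_j^k(y) for some k ≥ i, j.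

module _ {I : Set} (dir : Directed I) where
  open Directed dir

  record IsColimSort (X : I → Set) (ψ : ∀ {i j} → i ≤ j → X i → X j)
                     (X* : Set) (ι : ∀ i → X i → X*) : Set where
    field
      cocone : ∀ {i j} (p : i ≤ j) x → ι j (ψ p x) ≡ ι i x
      jsurj  : ∀ y → Σ I λ i → Σ (X i) λ x → ι i x ≡ y
      eqChar : ∀ i j x y → ι i x ≡ ι j y ⟺
                 (Σ I λ k → Σ (i ≤ k) λ p → Σ (j ≤ k) λ q → ψ p x ≡ ψ q y)

  module _ (S : DirSys dir) (T* : RawStr) (ι : ∀ i → SortMaps (DirSys.T S i) T*) where
    private
      module S = DirSys S
      module T* = RawStr T*
      module Ti (i : I) = RawStr (S.T i)
      module ιi (i : I) = SortMaps (ι i)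

    record IsDirectLimit : Set where
      field
        limA : IsColimSort (λ i → Ti.A i) (λ p → SortMaps.mA (S.Φ p)) T*.A (λ i → ιi.mA i)
        limF : IsColimSort (λ i → Ti.F i) (λ p → SortMaps.mF (S.Φ p)) T*.F (λ i → ιi.mF i)
        limD : IsColimSort (λ i → Ti.D i) (λ p → SortMaps.mD (S.Φ p)) T*.D (λ i → ιi.mD i)
        limG : IsColimSort (λ i → Ti.G i) (λ p → SortMaps.mG (S.Φ p)) T*.G (λ i → ιi.mG i)
        memRep : ∀ i x X → T*.mem (ιi.mA i x) (ιi.mF i X) ⟺ Ti.mem i x X
        hdRep : ∀ i d a b → (a , b) ∈L T*.hd (ιi.mD i d) ⟺
                  (∃ λ x → ∃ λ y → (x , y) ∈L Ti.hd i d × ιi.mA i x ≡ a × ιi.mA i y ≡ b)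
        fdRep : ∀ i d A B → (A , B) ∈L T*.fd (ιi.mD i d) ⟺
                  (∃ λ X → ∃ λ Y → (X , Y) ∈L Ti.fd i d × ιi.mF i X ≡ A × ιi.mF i Y ≡ B)
        mulRep : ∀ i g g' → ιi.mG i (Ti._·_ i g g') ≡ T*._·_ (ιi.mG i g) (ιi.mG i g')
        eRep   : ∀ i → ιi.mG i (Ti.e i) ≡ T*.e
        invRep : ∀ i g → ιi.mG i (Ti.inv i g) ≡ T*.inv (ιi.mG i g)
        actRep  : ∀ i g x → T*.act (ιi.mG i g) (ιi.mA i x) ≡ ιi.mA i (Ti.act i g x)
        actFRep : ∀ i g X → T*.actF (ιi.mG i g) (ιi.mF i X) ≡ ιi.mF i (Ti.actF i g X)
        -- φ* via representatives; dom φ* = ⋃ Φ_i[dom φ_i]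
        φRep : ∀ i d g → Ti.φ i d ≡ just g → T*.φ (ιi.mD i d) ≡ just (ιi.mG i g)
        φDom : ∀ d* g* → T*.φ d* ≡ just g* →
                 Σ I λ i → Σ (Ti.D i) λ d → Σ (Ti.G i) λ g → Ti.φ i d ≡ just g × ιi.mD i d ≡ d*

{-# OPTIONS --safe #-}
module Submission where

open import Defs
open import Data.Product using (Σ; ∃; _×_; _,_; proj₁; proj₂)
import Data.Product as Prod
open import Data.Maybe using (just)
open import Data.Maybe.Properties using (just-injective)
open import Data.List using (List; []; _∷_; map)
open import Data.List.Properties using (map-∘; map-cong)
open import Data.List.Membership.Propositional using (_∈_)
open import Data.List.Membership.Propositional.Properties using (∈-map⁺; ∈-map⁻)
open import Function.Definitions using (Injective)
open import Algebra.Structures using (IsGroup)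
open import Relation.Binary.PropositionalEquality
  using (_≡_; refl; sym; trans; cong; cong₂; subst; subst₂; isEquivalence; module ≡-Reasoning)

-- Any finitely many elements of T*, of whatever sorts, have representatives in one
-- common T_k, and the canonical maps are injective because the transition maps are.
-- Hence every axiom of a structure, which only ever speaks about finitely many
-- elements (demands being finite), transfers from some T_k to T*.  A demand of T* is
-- Φ_i(d) for some d ∈ D_i; successfulness gives j ≥ i with Φ_i^j(d) ∈ dom φ_j, so
-- Φ_i(d) ∈ dom φ*, and satisfaction transfers as well.  Homogeneity follows because
-- every demand on F* is (the graph of) an element of D*.

⟺-sym : ∀ {a b} {P : Set a} {Q : Set b} → P ⟺ Q → Q ⟺ P
⟺-sym (f , g) = g , f

⟺-trans : ∀ {a b c} {P : Set a} {Q : Set b} {R : Set c} → P ⟺ Q → Q ⟺ R → P ⟺ R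
⟺-trans (f , g) (h , k) = (λ x → h (f x)) , (λ x → g (k x))

both : {X Y : Set} → (X → Y) → X × X → Y × Y
both f = Prod.map f f

module CommonStage {I : Set} (dir : Directed I) where
  open Directed dir

  Monotone : (I → Set) → Set
  Monotone P = ∀ {i k} → i ≤ k → P i → P k

  common₂ : {P Q : I → Set} → Monotone P → Monotone Q →
            Σ I P → Σ I Q → Σ I λ k → P k × Q k
  common₂ mP mQ (i , x) (j , y) with bound i j
  ... | k , p , q = k , mP p x , mQ q y

  common₃ : {P Q R : I → Set} → Monotone P → Monotone Q → Monotone R →
            Σ I P → Σ I Q → Σ I R → Σ I λ k → P k × Q k × R k
  common₃ {Q = Q} {R} mP mQ mR x y z =
    common₂ {Q = λ k → Q k × R k} mP (λ p (y , z) → mQ p y , mR p z) x (common₂ mQ mR y z)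

module GraphImage {X Y : Set} (ι : X → Y) where

  IsGraphImage : List (X × X) → List (Y × Y) → Set
  IsGraphImage h h* = ∀ a b → (a , b) ∈ h* ⟺
    (∃ λ x → ∃ λ y → (x , y) ∈ h × ι x ≡ a × ι y ≡ b)

  ∈-graphImage : ∀ {h h* x y} → IsGraphImage h h* → (x , y) ∈ h → (ι x , ι y) ∈ h*
  ∈-graphImage {x = x} {y} G m = proj₂ (G _ _) (x , y , m , refl , refl)

  graphImage-map : ∀ h → IsGraphImage h (map (both ι) h)
  graphImage-map h a b = to , from
    where
    to : (a , b) ∈ map (both ι) h → ∃ λ x → ∃ λ y → (x , y) ∈ h × ι x ≡ a × ι y ≡ b
    to m with ∈-map⁻ (both ι) m
    ... | (x , y) , m′ , refl = x , y , m′ , refl , refl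
    from : (∃ λ x → ∃ λ y → (x , y) ∈ h × ι x ≡ a × ι y ≡ b) → (a , b) ∈ map (both ι) h
    from (x , y , m , refl , refl) = ∈-map⁺ (both ι) m

  graphImage-resp : ∀ {h h′ h*} → SameGraph h h′ → IsGraphImage h h* → IsGraphImage h′ h*
  graphImage-resp S G a b = ⟺-trans (G a b)
    ( (λ (x , y , m , ex , ey) → x , y , proj₁ (S _) m , ex , ey)
    , (λ (x , y , m , ex , ey) → x , y , proj₂ (S _) m , ex , ey))

  graphImage-unique : ∀ {h h* h*′} → IsGraphImage h h* → IsGraphImage h h*′ → SameGraph h* h*′
  graphImage-unique G G′ (a , b) = ⟺-trans (G a b) (⟺-sym (G′ a b))

  graphImage-Dom : ∀ {h h*} → IsGraphImage h h* →
                   ∀ a → Dom h* a ⟺ ∃ λ x → Dom h x × ι x ≡ a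
  graphImage-Dom G a =
      (λ (b , m) → let x , y , m′ , ex , _ = proj₁ (G a b) m in x , (y , m′) , ex)
    , (λ (x , (y , m) , ex) → ι y , proj₂ (G a (ι y)) (x , y , m , ex , refl))

  module _ (ι-injective : Injective _≡_ _≡_ ι) where

    ∈-graphImage⁻ : ∀ {h h* x y} → IsGraphImage h h* → (ι x , ι y) ∈ h* → (x , y) ∈ h
    ∈-graphImage⁻ G m with proj₁ (G _ _) m
    ... | _ , _ , m′ , ex , ey with ι-injective ex | ι-injective ey
    ... | refl | refl = m′

    graphImage-reflects-SameGraph : ∀ {h h′ h* h*′} → IsGraphImage h h* → IsGraphImage h′ h*′ →
                                    SameGraph h* h*′ → SameGraph h h′
    graphImage-reflects-SameGraph G G′ S _ =
        (λ m → ∈-graphImage⁻ G′ (proj₁ (S _) (∈-graphImage G m)))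
      , (λ m → ∈-graphImage⁻ G (proj₂ (S _) (∈-graphImage G′ m)))

    graphImage-IsFinPInj : ∀ {h h*} → IsGraphImage h h* → IsFinPInj h ⟺ IsFinPInj h*
    graphImage-IsFinPInj {h} {h*} G = to , from
      where
      to : IsFinPInj h → IsFinPInj h*
      to (functional , injective) = functional* , injective*
        where
        functional* : ∀ {a b b′} → (a , b) ∈ h* → (a , b′) ∈ h* → b ≡ b′
        functional* m m′ with proj₁ (G _ _) m | proj₁ (G _ _) m′
        ... | x , y , n , refl , refl | x′ , y′ , n′ , ex , refl with ι-injective ex
        ... | refl = cong ι (functional n n′)
        injective* : ∀ {a a′ b} → (a , b) ∈ h* → (a′ , b) ∈ h* → a ≡ a′
        injective* m m′ with proj₁ (G _ _) m | proj₁ (G _ _) m′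
        ... | x , y , n , refl , refl | x′ , y′ , n′ , refl , ey with ι-injective ey
        ... | refl = cong ι (injective n n′)
      from : IsFinPInj h* → IsFinPInj h
      from (functional* , injective*) =
          (λ m m′ → ι-injective (functional* (∈-graphImage G m) (∈-graphImage G m′)))
        , (λ m m′ → ι-injective (injective* (∈-graphImage G m) (∈-graphImage G m′)))

module DemandTransfer {A F A* F* : Set} (mem : A → F → Set) (mem* : A* → F* → Set)
  {ιA : A → A*} {ιF : F → F*} (ιA-injective : Injective _≡_ _≡_ ιA)
  (ιF-injective : Injective _≡_ _≡_ ιF) (mem-ι : ∀ x X → mem* (ιA x) (ιF X) ⟺ mem x X) where
  open GraphImage

  isDemand-graphImage : ∀ {h f h* f*} → IsGraphImage ιA h h* → IsGraphImage ιF f f* →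
                        IsDemand mem h f ⟺ IsDemand mem* h* f*
  isDemand-graphImage {h} {f} {h*} {f*} Gh Gf = to , from
    where
    to : IsDemand mem h f → IsDemand mem* h* f*
    to (h-inj , f-inj , compatible) =
        proj₁ (graphImage-IsFinPInj ιA ιA-injective Gh) h-inj
      , proj₁ (graphImage-IsFinPInj ιF ιF-injective Gf) f-inj
      , compatible*
      where
      compatible* : ∀ {a b A B} → (a , b) ∈ h* → (A , B) ∈ f* → mem* a A ⟺ mem* b B
      compatible* m n with proj₁ (Gh _ _) m | proj₁ (Gf _ _) n
      ... | x , y , m′ , refl , refl | X , Y , n′ , refl , refl =
        ⟺-trans (mem-ι x X) (⟺-trans (compatible m′ n′) (⟺-sym (mem-ι y Y)))
    from : IsDemand mem* h* f* → IsDemand mem h f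
    from (h*-inj , f*-inj , compatible*) =
        proj₂ (graphImage-IsFinPInj ιA ιA-injective Gh) h*-inj
      , proj₂ (graphImage-IsFinPInj ιF ιF-injective Gf) f*-inj
      , λ {x} {y} {X} {Y} m n → ⟺-trans (⟺-sym (mem-ι x X))
          (⟺-trans (compatible* (∈-graphImage ιA Gh m) (∈-graphImage ιF Gf n)) (mem-ι y Y))

module GroupActionAut {A F G : Set} (mem : A → F → Set) {_·_ : G → G → G} {e : G} {inv : G → G}
  (group : IsGroup _≡_ _·_ e inv) (act : G → A → A) (actF : G → F → F)
  (act-hom : ∀ g g′ x → act (g · g′) x ≡ act g (act g′ x)) (act-identity : ∀ x → act e x ≡ x)
  (actF-image : ∀ g X b → mem b (actF g X) ⟺ Image mem (act g) (λ a → mem a X) b) where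
  open IsGroup group using (inverseˡ; inverseʳ)
  open ≡-Reasoning

  act-inverseˡ : ∀ g x → act (inv g) (act g x) ≡ x
  act-inverseˡ g x = begin
    act (inv g) (act g x) ≡⟨ sym (act-hom (inv g) g x) ⟩
    act (inv g · g) x     ≡⟨ cong (λ h → act h x) (inverseˡ g) ⟩
    act e x               ≡⟨ act-identity x ⟩
    x                     ∎

  act-inverseʳ : ∀ g x → act g (act (inv g) x) ≡ x
  act-inverseʳ g x = begin
    act g (act (inv g) x) ≡⟨ sym (act-hom g (inv g) x) ⟩
    act (g · inv g) x     ≡⟨ cong (λ h → act h x) (inverseʳ g) ⟩
    act e x               ≡⟨ act-identity x ⟩
    x                     ∎

  isAut-act : ∀ g → IsAut mem (act g)
  isAut-act g = isPerm , inFam-image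
    where
    isPerm : IsPerm mem (act g)
    isPerm = (λ {x} {x′} eq → trans (sym (act-inverseˡ g x))
                                (trans (cong (act (inv g)) eq) (act-inverseˡ g x′)))
           , λ y → act (inv g) y , act-inverseʳ g y
    inFam-image : ∀ P → InFam mem P ⟺ InFam mem (Image mem (act g) P)
    inFam-image P = to , from
      where
      to : InFam mem P → InFam mem (Image mem (act g) P)
      to (X , X≈P) = actF g X , λ b → ⟺-trans (actF-image g X b)
        ( (λ (a , m , eq) → a , proj₁ (X≈P a) m , eq)
        , (λ (a , Pa , eq) → a , proj₂ (X≈P a) Pa , eq))
      from : InFam mem (Image mem (act g) P) → InFam mem P
      from (Y , Y≈gP) = actF (inv g) Y , λ a → mem→P a , P→mem a
        where
        mem→P : ∀ a → mem a (actF (inv g) Y) → P a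
        mem→P a m with proj₁ (actF-image (inv g) Y a) m
        ... | b , mb , refl with proj₁ (Y≈gP b) mb
        ... | c , Pc , refl = subst P (sym (act-inverseˡ g c)) Pc
        P→mem : ∀ a → P a → mem a (actF (inv g) Y)
        P→mem a Pa = proj₂ (actF-image (inv g) Y a)
          (act g a , proj₂ (Y≈gP (act g a)) (a , Pa , refl) , act-inverseˡ g a)

module StructureProperties {T : RawStr} (isStr : IsStructure T) where
  open RawStr T
  open IsStructure isStr
  open IsGroup group using (identityˡ)

  act-identity : ∀ x → act e x ≡ x
  act-identity x = proj₁ (proj₁ (actAut e))
    (trans (sym (actHom e e x)) (cong (λ g → act g x) (identityˡ e)))

  satisfies⇒fd≡actF : ∀ {g d X Y} → Satisfies mem (act g) (hd d) (fd d) →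
                      (X , Y) ∈ fd d → Y ≡ actF g X
  satisfies⇒fd≡actF {g} {X = X} (_ , onSets) m =
    ext _ _ λ a → ⟺-trans (onSets m a) (⟺-sym (actFSet g X a))

  homogeneous-if-φ-total : (∀ d → ∃ λ g → φ d ≡ just g) → Homogeneous mem
  homogeneous-if-φ-total φ-total h f isDemand with demandSurj h f isDemand
  ... | d , h≈ , f≈ with φ-total d
  ... | g , eq with φSat d g eq
  ... | onPoints , onSets =
    act g , actAut g , (λ m → onPoints (proj₂ (h≈ _) m)) , (λ m → onSets (proj₂ (f≈ _) m))

module ColimitSort {I : Set} (dir : Directed I)
  (X : I → Set) (ψ : ∀ {i j} → Directed._≤_ dir i j → X i → X j) (X* : Set) (ι : ∀ i → X i → X*)
  (colim : IsColimSort dir X ψ X* ι)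
  (ψ-id : ∀ {i} (p : Directed._≤_ dir i i) x → ψ p x ≡ x)
  (ψ-∘ : ∀ {i j k} (p : Directed._≤_ dir i j) (q : Directed._≤_ dir j k) (r : Directed._≤_ dir i k) x →
           ψ q (ψ p x) ≡ ψ r x)
  (ψ-injective : ∀ {i j} (p : Directed._≤_ dir i j) → Injective _≡_ _≡_ (ψ p)) where
  open Directed dir
  open IsColimSort colim public
  open CommonStage dir

  ψ-irrelevant : ∀ {i j} (p q : i ≤ j) x → ψ p x ≡ ψ q x
  ψ-irrelevant {j = j} p q x = trans (sym (ψ-id (refl≤ j) (ψ p x))) (ψ-∘ p (refl≤ j) q x)

  ι-injective : ∀ {i} → Injective _≡_ _≡_ (ι i)
  ι-injective {i} {x} {y} eq with proj₁ (eqChar i i x y) eq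
  ... | k , p , q , ψx≡ψy = ψ-injective p (trans ψx≡ψy (ψ-irrelevant q p y))

  Rep : I → X* → Set
  Rep k y = Σ (X k) λ x → ι k x ≡ y

  Rep-mono : ∀ {y} → Monotone (λ k → Rep k y)
  Rep-mono p (x , eq) = ψ p x , trans (cocone p x) eq

  rep₂ : ∀ y y′ → Σ I λ k → Rep k y × Rep k y′
  rep₂ y y′ = common₂ Rep-mono Rep-mono (jsurj y) (jsurj y′)

  rep₃ : ∀ y y′ y″ → Σ I λ k → Rep k y × Rep k y′ × Rep k y″
  rep₃ y y′ y″ = common₃ Rep-mono Rep-mono Rep-mono (jsurj y) (jsurj y′) (jsurj y″)

  ListRep : I → List (X* × X*) → Set
  ListRep k L = Σ (List (X k × X k)) λ L′ → map (both (ι k)) L′ ≡ L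

  ListRep-mono : ∀ {L} → Monotone (λ k → ListRep k L)
  ListRep-mono p (L′ , refl) = map (both (ψ p)) L′ ,
    trans (sym (map-∘ L′)) (map-cong (λ (x , y) → cong₂ _,_ (cocone p x) (cocone p y)) L′)

  listRep : ∀ L → Σ I λ k → ListRep k L
  listRep [] = inhabited , [] , refl
  listRep ((a , b) ∷ L) with common₃ Rep-mono Rep-mono ListRep-mono (jsurj a) (jsurj b) (listRep L)
  ... | k , (x , refl) , (y , refl) , (L′ , refl) = k , (x , y) ∷ L′ , refl

module DirectLimit {I : Set} (dir : Directed I) (S : DirSys dir) (success : DirSys.SuccessfulSys S)
  (T* : RawStr) (ι : ∀ i → SortMaps (DirSys.T S i) T*) (lim : IsDirectLimit dir S T* ι) where
  open Directed dir
  open CommonStage dir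
  open GraphImage using (graphImage-map; graphImage-resp; graphImage-unique; graphImage-Dom;
    ∈-graphImage; graphImage-reflects-SameGraph)
  open IsDirectLimit lim
  open ≡-Reasoning
  private module S = DirSys S
  open RawStr T* using () renaming (A to A*; F to F*; D to D*; G to G*; mem to mem*; hd to hd*;
    fd to fd*; _·_ to _·*_; e to e*; inv to inv*; act to act*; actF to actF*; φ to φ*)
  module Ti (i : I) = RawStr (S.T i)
  module Si (i : I) = IsStructure (S.isStr i)
  module Gi (i : I) = IsGroup (Si.group i)
  module ME {i j} (p : i ≤ j) = IsMultiEmb (S.isME p)

  ιA : ∀ i → Ti.A i → A*
  ιA i = SortMaps.mA (ι i)
  ιF : ∀ i → Ti.F i → F*
  ιF i = SortMaps.mF (ι i)
  ιD : ∀ i → Ti.D i → D*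
  ιD i = SortMaps.mD (ι i)
  ιG : ∀ i → Ti.G i → G*
  ιG i = SortMaps.mG (ι i)

  mul : ∀ k → Ti.G k → Ti.G k → Ti.G k
  mul k = Ti._·_ k
  syntax mul k a b = a ·[ k ] b

  module CA = ColimitSort dir (λ i → Ti.A i) (λ p → SortMaps.mA (S.Φ p)) A* ιA limA S.idA S.compA ME.injA
  module CF = ColimitSort dir (λ i → Ti.F i) (λ p → SortMaps.mF (S.Φ p)) F* ιF limF S.idF S.compF ME.injF
  module CD = ColimitSort dir (λ i → Ti.D i) (λ p → SortMaps.mD (S.Φ p)) D* ιD limD S.idD S.compD ME.injD
  module CG = ColimitSort dir (λ i → Ti.G i) (λ p → SortMaps.mG (S.Φ p)) G* ιG limG S.idG S.compG ME.injG

  module DT (k : I) = DemandTransfer (Ti.mem k) mem* CA.ι-injective CF.ι-injective (memRep k)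

  ext* : ∀ X Y → (∀ a → mem* a X ⟺ mem* a Y) → X ≡ Y
  ext* X Y X≈Y with CF.rep₂ X Y
  ... | k , (X₀ , refl) , (Y₀ , refl) = cong (ιF k) (Si.ext k X₀ Y₀ λ a →
    ⟺-trans (⟺-sym (memRep k a X₀)) (⟺-trans (X≈Y (ιA k a)) (memRep k a Y₀)))

  demand* : ∀ d → IsDemand mem* (hd* d) (fd* d)
  demand* d with CD.jsurj d
  ... | i , d₀ , refl = proj₁ (DT.isDemand-graphImage i (hdRep i d₀) (fdRep i d₀)) (Si.demand i d₀)

  demandInj* : ∀ d d′ → SameGraph (hd* d) (hd* d′) → SameGraph (fd* d) (fd* d′) → d ≡ d′
  demandInj* d d′ h≈ f≈ with CD.rep₂ d d′
  ... | k , (d₀ , refl) , (d₀′ , refl) = cong (ιD k) (Si.demandInj k d₀ d₀′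
    (graphImage-reflects-SameGraph (ιA k) CA.ι-injective (hdRep k d₀) (hdRep k d₀′) h≈)
    (graphImage-reflects-SameGraph (ιF k) CF.ι-injective (fdRep k d₀) (fdRep k d₀′) f≈))

  demandSurj* : ∀ h f → IsDemand mem* h f → ∃ λ d → SameGraph (hd* d) h × SameGraph (fd* d) f
  demandSurj* h f isDemand
    with common₂ CA.ListRep-mono CF.ListRep-mono (CA.listRep h) (CF.listRep f)
  ... | k , (h₀ , refl) , (f₀ , refl)
    with Si.demandSurj k h₀ f₀
           (proj₂ (DT.isDemand-graphImage k (graphImage-map (ιA k) h₀) (graphImage-map (ιF k) f₀))
                  isDemand)
  ... | d , h≈ , f≈ = ιD k d
    , graphImage-unique (ιA k) (graphImage-resp (ιA k) h≈ (hdRep k d)) (graphImage-map (ιA k) h₀)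
    , graphImage-unique (ιF k) (graphImage-resp (ιF k) f≈ (fdRep k d)) (graphImage-map (ιF k) f₀)

  ·*-assoc : ∀ x y z → (x ·* y) ·* z ≡ x ·* (y ·* z)
  ·*-assoc x y z with CG.rep₃ x y z
  ... | k , (a , refl) , (b , refl) , (c , refl) = begin
    (ιG k a ·* ιG k b) ·* ιG k c   ≡⟨ cong (_·* ιG k c) (sym (mulRep k a b)) ⟩
    ιG k (a ·[ k ] b) ·* ιG k c    ≡⟨ sym (mulRep k _ c) ⟩
    ιG k ((a ·[ k ] b) ·[ k ] c)   ≡⟨ cong (ιG k) (Gi.assoc k a b c) ⟩
    ιG k (a ·[ k ] (b ·[ k ] c))   ≡⟨ mulRep k a _ ⟩
    ιG k a ·* ιG k (b ·[ k ] c)    ≡⟨ cong (ιG k a ·*_) (mulRep k b c) ⟩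
    ιG k a ·* (ιG k b ·* ιG k c)   ∎

  ·*-identityˡ : ∀ x → e* ·* x ≡ x
  ·*-identityˡ x with CG.jsurj x
  ... | i , a , refl = begin
    e* ·* ιG i a             ≡⟨ cong (_·* ιG i a) (sym (eRep i)) ⟩
    ιG i (Ti.e i) ·* ιG i a  ≡⟨ sym (mulRep i _ a) ⟩
    ιG i (Ti.e i ·[ i ] a)   ≡⟨ cong (ιG i) (Gi.identityˡ i a) ⟩
    ιG i a                   ∎

  ·*-identityʳ : ∀ x → x ·* e* ≡ x
  ·*-identityʳ x with CG.jsurj x
  ... | i , a , refl = begin
    ιG i a ·* e*             ≡⟨ cong (ιG i a ·*_) (sym (eRep i)) ⟩
    ιG i a ·* ιG i (Ti.e i)  ≡⟨ sym (mulRep i a _) ⟩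
    ιG i (a ·[ i ] Ti.e i)   ≡⟨ cong (ιG i) (Gi.identityʳ i a) ⟩
    ιG i a                   ∎

  ·*-inverseˡ : ∀ x → inv* x ·* x ≡ e*
  ·*-inverseˡ x with CG.jsurj x
  ... | i , a , refl = begin
    inv* (ιG i a) ·* ιG i a        ≡⟨ cong (_·* ιG i a) (sym (invRep i a)) ⟩
    ιG i (Ti.inv i a) ·* ιG i a    ≡⟨ sym (mulRep i _ a) ⟩
    ιG i (Ti.inv i a ·[ i ] a)     ≡⟨ cong (ιG i) (Gi.inverseˡ i a) ⟩
    ιG i (Ti.e i)                  ≡⟨ eRep i ⟩
    e*                             ∎

  ·*-inverseʳ : ∀ x → x ·* inv* x ≡ e*
  ·*-inverseʳ x with CG.jsurj x
  ... | i , a , refl = begin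
    ιG i a ·* inv* (ιG i a)        ≡⟨ cong (ιG i a ·*_) (sym (invRep i a)) ⟩
    ιG i a ·* ιG i (Ti.inv i a)    ≡⟨ sym (mulRep i a _) ⟩
    ιG i (a ·[ i ] Ti.inv i a)     ≡⟨ cong (ιG i) (Gi.inverseʳ i a) ⟩
    ιG i (Ti.e i)                  ≡⟨ eRep i ⟩
    e*                             ∎

  group* : IsGroup _≡_ _·*_ e* inv*
  group* = record
    { isMonoid = record
      { isSemigroup = record
        { isMagma = record { isEquivalence = isEquivalence ; ∙-cong = cong₂ _·*_ }
        ; assoc = ·*-assoc }
      ; identity = ·*-identityˡ , ·*-identityʳ }
    ; inverse = ·*-inverseˡ , ·*-inverseʳ
    ; ⁻¹-cong = cong inv* }

  act*-hom : ∀ g g′ x → act* (g ·* g′) x ≡ act* g (act* g′ x)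
  act*-hom g g′ x
    with common₃ CG.Rep-mono CG.Rep-mono CA.Rep-mono (CG.jsurj g) (CG.jsurj g′) (CA.jsurj x)
  ... | k , (a , refl) , (b , refl) , (c , refl) = begin
    act* (ιG k a ·* ιG k b) (ιA k c)        ≡⟨ cong (λ h → act* h (ιA k c)) (sym (mulRep k a b)) ⟩
    act* (ιG k (a ·[ k ] b)) (ιA k c)       ≡⟨ actRep k _ c ⟩
    ιA k (Ti.act k (a ·[ k ] b) c)          ≡⟨ cong (ιA k) (Si.actHom k a b c) ⟩
    ιA k (Ti.act k a (Ti.act k b c))        ≡⟨ sym (actRep k a _) ⟩
    act* (ιG k a) (ιA k (Ti.act k b c))     ≡⟨ cong (act* (ιG k a)) (sym (actRep k b c)) ⟩
    act* (ιG k a) (act* (ιG k b) (ιA k c))  ∎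

  act*-identity : ∀ x → act* e* x ≡ x
  act*-identity x with CA.jsurj x
  ... | i , a , refl = begin
    act* e* (ιA i a)             ≡⟨ cong (λ h → act* h (ιA i a)) (sym (eRep i)) ⟩
    act* (ιG i (Ti.e i)) (ιA i a) ≡⟨ actRep i _ a ⟩
    ιA i (Ti.act i (Ti.e i) a)   ≡⟨ cong (ιA i) (StructureProperties.act-identity (S.isStr i) a) ⟩
    ιA i a                       ∎

  faithful* : ∀ g g′ → (∀ x → act* g x ≡ act* g′ x) → g ≡ g′
  faithful* g g′ g≈g′ with CG.rep₂ g g′
  ... | k , (a , refl) , (b , refl) = cong (ιG k) (Si.faithful k a b λ x →
    CA.ι-injective (trans (sym (actRep k a x)) (trans (g≈g′ (ιA k x)) (actRep k b x))))

  actF*-image : ∀ g X b → mem* b (actF* g X) ⟺ Image mem* (act* g) (λ a → mem* a X) b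
  actF*-image g X b = to , from
    where
    to : mem* b (actF* g X) → Image mem* (act* g) (λ a → mem* a X) b
    to m with common₃ CG.Rep-mono CF.Rep-mono CA.Rep-mono (CG.jsurj g) (CF.jsurj X) (CA.jsurj b)
    ... | k , (g₀ , refl) , (X₀ , refl) , (b₀ , refl)
      with proj₁ (Si.actFSet k g₀ X₀ b₀)
             (proj₁ (memRep k b₀ _) (subst (mem* (ιA k b₀)) (actFRep k g₀ X₀) m))
    ... | a₀ , m₀ , refl = ιA k a₀ , proj₂ (memRep k a₀ X₀) m₀ , actRep k g₀ a₀
    from : Image mem* (act* g) (λ a → mem* a X) b → mem* b (actF* g X)
    from (a , m , refl)
      with common₃ CG.Rep-mono CF.Rep-mono CA.Rep-mono (CG.jsurj g) (CF.jsurj X) (CA.jsurj a)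
    ... | k , (g₀ , refl) , (X₀ , refl) , (a₀ , refl) =
      subst₂ mem* (sym (actRep k g₀ a₀)) (sym (actFRep k g₀ X₀)) ga₀∈gX₀
      where
      ga₀∈gX₀ : mem* (ιA k (Ti.act k g₀ a₀)) (ιF k (Ti.actF k g₀ X₀))
      ga₀∈gX₀ = proj₂ (memRep k _ _)
        (proj₂ (Si.actFSet k g₀ X₀ _) (a₀ , proj₁ (memRep k a₀ X₀) m , refl))

  satisfies-ι : ∀ i d g → Satisfies (Ti.mem i) (Ti.act i g) (Ti.hd i d) (Ti.fd i d) →
                Satisfies mem* (act* (ιG i g)) (hd* (ιD i d)) (fd* (ιD i d))
  satisfies-ι i d g sat@(onPoints , _) = onPoints* , onSets*
    where
    onPoints* : ∀ {a b} → (a , b) ∈ hd* (ιD i d) → act* (ιG i g) a ≡ b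
    onPoints* m with proj₁ (hdRep i d _ _) m
    ... | x , y , m′ , refl , refl = trans (actRep i g x) (cong (ιA i) (onPoints m′))
    onSets* : ∀ {A B} → (A , B) ∈ fd* (ιD i d) →
              ∀ b → mem* b B ⟺ Image mem* (act* (ιG i g)) (λ a → mem* a A) b
    onSets* m b with proj₁ (fdRep i d _ _) m
    ... | X , Y , m′ , refl , refl
      with StructureProperties.satisfies⇒fd≡actF (S.isStr i) sat m′
    ... | refl = subst (λ B → mem* b B ⟺ Image mem* (act* (ιG i g)) (λ a → mem* a (ιF i X)) b)
                       (actFRep i g X) (actF*-image (ιG i g) (ιF i X) b)

  φ*-satisfies : ∀ d g → φ* d ≡ just g → Satisfies mem* (act* g) (hd* d) (fd* d)
  φ*-satisfies d g eq with φDom d g eq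
  ... | i , d₀ , g₀ , eq₀ , refl with just-injective (trans (sym eq) (φRep i d₀ g₀ eq₀))
  ... | refl = satisfies-ι i d₀ g₀ (Si.φSat i d₀ g₀ eq₀)

  φ*-total : ∀ d → ∃ λ g → φ* d ≡ just g
  φ*-total d with CD.jsurj d
  ... | i , d₀ , refl with success i
  ... | j , p , Φ-successful with Φ-successful d₀
  ... | g , eq = ιG j g , subst (λ d → φ* d ≡ just (ιG j g)) (CD.cocone p d₀) (φRep j _ g eq)

  isStructure* : IsStructure T*
  isStructure* = record
    { ext = ext* ; demand = demand* ; demandInj = demandInj* ; demandSurj = demandSurj*
    ; group = group* ; actAut = GroupActionAut.isAut-act mem* group* act* actF* act*-hom act*-identity actF*-image
    ; actHom = act*-hom ; faithful = faithful* ; actFSet = actF*-image ; φSat = φ*-satisfies }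

  ι-isMultiEmb : ∀ i → IsMultiEmb (ι i)
  ι-isMultiEmb i = record
    { injA = CA.ι-injective ; injF = CF.ι-injective ; injD = CD.ι-injective ; injG = CG.ι-injective
    ; homG = mulRep i
    ; memPres = λ x X → ⟺-sym (memRep i x X)
    ; hDom = λ d → graphImage-Dom (ιA i) (hdRep i d)
    ; fDom = λ d → graphImage-Dom (ιF i) (fdRep i d)
    ; hVal = λ d → ∈-graphImage (ιA i) (hdRep i d)
    ; fVal = λ d → ∈-graphImage (ιF i) (fdRep i d)
    ; actPres = λ g x → sym (actRep i g x)
    ; actFPres = λ g X → sym (actFRep i g X)
    ; φPres = φRep i }

theorem2p3 : {I : Set} (dir : Directed I) (S : DirSys dir) → DirSys.SuccessfulSys S →
    (T* : RawStr) (ι : ∀ i → SortMaps (DirSys.T S i) T*) → IsDirectLimit dir S T* ι →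
    Homogeneous (RawStr.mem T*)
    × IsStructure T*
    × (∀ d → Σ (RawStr.G T*) λ g → RawStr.φ T* d ≡ just g
         × Satisfies (RawStr.mem T*) (RawStr.act T* g) (RawStr.hd T* d) (RawStr.fd T* d))
    × (∀ i → IsMultiEmb (ι i) × Successful (ι i))
theorem2p3 dir S success T* ι lim =
    StructureProperties.homogeneous-if-φ-total isStructure* φ*-total
  , isStructure*
  , (λ d → let g , eq = φ*-total d in g , eq , φ*-satisfies d g eq)
  , λ i → ι-isMultiEmb i , λ d → φ*-total (ιD i d)
  where open DirectLimit dir S success T* ι lim
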